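{- For every positive integer $k$, the number of distinct degree enumerators $e(G)$ of simple graphs $G$ on vertex set $\{0,1,\dots,2k\}$ is at least $\binom{2k}{k}$.
   Context: For a simple graph $G$ on $N$ vertices, its degree enumerator is $e(G)=(e_0(G),\dots,e_{N-1}(G))$ where $e_i(G)$ is the number of vertices of $G$ of degree $i$. -}

module Defs where

open import Data.Nat using (ℕ; _≟_)
open import Data.Bool using (Bool; false)
open import Data.Fin using (Fin; toℕ)
open import Data.Vec using (Vec; tabulate; allFin; count; countᵇ)
open import Relation.Binary.PropositionalEquality using (_≡_)

record SimpleGraph (N : ℕ) : Set where
  field
    adj    : Fin N → Fin N → Bool
    sym    : ∀ i j → adj i j ≡ adj j i
    irrefl : ∀ i → adj i i ≡ false

open SimpleGraph public

degree : ∀ {N} → SimpleGraph N → Fin N → ℕ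
degree {N} G i = countᵇ (adj G i) (allFin N)

enumEntry : ∀ {N} → SimpleGraph N → ℕ → ℕ
enumEntry {N} G d = count (λ i → degree G i ≟ d) (allFin N)

degreeEnumerator : ∀ {N} → SimpleGraph N → Vec ℕ N
degreeEnumerator {N} G = tabulate (λ (d : Fin N) → enumEntry G (toℕ d))

-- A binary word b ∷ w is realised as the threshold graph obtained from that of w by
-- adding vertex 0, dominating if b is 1 and isolated if b is 0. The degree enumerator
-- recovers the word letter by letter: the first letter is 1 exactly when no vertex
-- has degree 0, and apart from the entry of the new vertex, adding a dominating
-- (isolated) vertex shifts (keeps) the enumerator. So distinct words give distinct
-- enumerators, and there are C(2k,k) words of length 2k with k ones.
module Submission where

open import Defs
open import Data.Nat using (ℕ; suc; _*_; _≤_)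
open import Data.Nat.Combinatorics using (_C_)
open import Data.Fin using (Fin)
open import Data.Product using (Σ)
open import Relation.Binary.PropositionalEquality using (_≡_)

open import Data.Bool using (Bool; true; false; if_then_else_; T?)
open import Data.Empty using (⊥-elim)
open import Data.Fin using (zero; suc; toℕ; fromℕ<; splitAt; join; cast)
open import Data.Fin.Properties using (join-splitAt; cast-involutive; toℕ-fromℕ<)
open import Data.Nat as ℕ using (zero; _<_; s≤s; z≤n; _≟_)
open import Data.Nat.Combinatorics using (nCk+nC[k+1]≡[n+1]C[k+1])
open import Data.Nat.Properties using (suc-injective; 0≢1+n; m<n⇒m<1+n)
open import Data.Product using (_,_)
open import Data.Sum using (inj₁; inj₂; [_,_]′)
open import Data.Unit using (tt)
open import Data.Vec using (Vec; []; _∷_; replicate; tabulate; allFin; count; lookup)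
open import Data.Vec.Properties using (∷-injectiveˡ; ∷-injectiveʳ; lookup∘tabulate)
open import Level using (Level)
open import Function using (_∘_; id)
open import Function.Definitions using (Injective)
open import Relation.Binary.PropositionalEquality
  using (refl; trans; cong; _≢_; module ≡-Reasoning) renaming (sym to ≡-sym)
open import Relation.Nullary using (¬_; does; yes; no)
open import Relation.Unary using (Pred; Decidable)

private
  variable
    A B D : Set
    m n : ℕ
    ℓ : Level

[,]-injective : {f : A → D} {g : B → D} → Injective _≡_ _≡_ f → Injective _≡_ _≡_ g →
                (∀ a b → f a ≢ g b) → Injective _≡_ _≡_ [ f , g ]′
[,]-injective f-inj g-inj disjoint {inj₁ a} {inj₁ a′} eq = cong inj₁ (f-inj eq)
[,]-injective f-inj g-inj disjoint {inj₁ a} {inj₂ b}  eq = ⊥-elim (disjoint a b eq)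
[,]-injective f-inj g-inj disjoint {inj₂ b} {inj₁ a}  eq = ⊥-elim (disjoint a b (≡-sym eq))
[,]-injective f-inj g-inj disjoint {inj₂ b} {inj₂ b′} eq = cong inj₂ (g-inj eq)

cast-injective : .(eq : m ≡ n) → Injective _≡_ _≡_ (cast eq)
cast-injective eq {i} {j} castᵢ≡castⱼ = begin
  i                           ≡⟨ cast-involutive (≡-sym eq) eq i ⟨
  cast (≡-sym eq) (cast eq i) ≡⟨ cong (cast (≡-sym eq)) castᵢ≡castⱼ ⟩
  cast (≡-sym eq) (cast eq j) ≡⟨ cast-involutive (≡-sym eq) eq j ⟩
  j                           ∎
  where open ≡-Reasoning

splitAt-injective : ∀ m {n} → Injective _≡_ _≡_ (splitAt m {n})
splitAt-injective m {n} {i} {j} eq = begin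
  i                      ≡⟨ join-splitAt m n i ⟨
  join m n (splitAt m i) ≡⟨ cong (join m n) eq ⟩
  join m n (splitAt m j) ≡⟨ join-splitAt m n j ⟩
  j                      ∎
  where open ≡-Reasoning

-- The characteristic vectors of the k-element subsets of an n-element set, listed
-- along Pascal's rule: those containing the first element, then those that do not.
combination : ∀ n k → Fin (n C k) → Vec Bool n
combination zero    k       _ = []
combination (suc n) zero    _ = replicate (suc n) false
combination (suc n) (suc k) x =
  [ (true ∷_) ∘ combination n k , (false ∷_) ∘ combination n (suc k) ]′
    (splitAt (n C k) (cast (≡-sym (nCk+nC[k+1]≡[n+1]C[k+1] n k)) x))

combination-injective : ∀ n k → Injective _≡_ _≡_ (combination n k)
combination-injective zero    zero    {zero} {zero} _ = refl
combination-injective (suc n) zero    {zero} {zero} _ = refl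
combination-injective (suc n) (suc k) =
  cast-injective (≡-sym (nCk+nC[k+1]≡[n+1]C[k+1] n k))
  ∘ splitAt-injective (n C k)
  ∘ [,]-injective (combination-injective n k ∘ ∷-injectiveʳ)
                  (combination-injective n (suc k) ∘ ∷-injectiveʳ)
                  (λ _ _ → (λ ()) ∘ ∷-injectiveˡ)

count-tabulate : {P : Pred A ℓ} (P? : Decidable P) (f : Fin n → A) →
                 count P? (tabulate f) ≡ count (P? ∘ f) (allFin n)
count-tabulate {n = zero}  P? f = refl
count-tabulate {n = suc n} P? f = cong (if does (P? (f zero)) then suc else id)
  (trans (count-tabulate P? (f ∘ suc)) (≡-sym (count-tabulate (P? ∘ f) suc)))

count-all : {P : Pred A ℓ} (P? : Decidable P) → (∀ x → P x) → (xs : Vec A n) → count P? xs ≡ n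
count-all P? all []       = refl
count-all P? all (x ∷ xs) with P? x
... | yes _  = cong suc (count-all P? all xs)
... | no ¬px = ⊥-elim (¬px (all x))

count-none : {P : Pred A ℓ} (P? : Decidable P) → (∀ x → ¬ P x) → (xs : Vec A n) → count P? xs ≡ 0
count-none P? none []       = refl
count-none P? none (x ∷ xs) with P? x
... | yes px = ⊥-elim (none x px)
... | no _   = count-none P? none xs

count-cong : {P Q : Pred A ℓ} (P? : Decidable P) (Q? : Decidable Q) →
             (∀ x → does (P? x) ≡ does (Q? x)) → (xs : Vec A n) → count P? xs ≡ count Q? xs
count-cong P? Q? same []       = refl
count-cong P? Q? same (x ∷ xs) with P? x | Q? x | same x
... | yes _ | yes _ | _ = cong suc (count-cong P? Q? same xs)
... | no _  | no _  | _ = count-cong P? Q? same xs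

suc-or-id-injective : ∀ c {m n} → (if c then ℕ.suc else id) m ≡ (if c then ℕ.suc else id) n → m ≡ n
suc-or-id-injective true  = suc-injective
suc-or-id-injective false = id

thresholdAdj : Vec Bool m → Fin (suc m) → Fin (suc m) → Bool
thresholdAdj []       _       _       = false
thresholdAdj (b ∷ bs) zero    zero    = false
thresholdAdj (b ∷ bs) zero    (suc j) = b
thresholdAdj (b ∷ bs) (suc i) zero    = b
thresholdAdj (b ∷ bs) (suc i) (suc j) = thresholdAdj bs i j

thresholdAdj-sym : (bs : Vec Bool m) → ∀ i j → thresholdAdj bs i j ≡ thresholdAdj bs j i
thresholdAdj-sym []       i       j       = refl
thresholdAdj-sym (b ∷ bs) zero    zero    = refl
thresholdAdj-sym (b ∷ bs) zero    (suc j) = refl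
thresholdAdj-sym (b ∷ bs) (suc i) zero    = refl
thresholdAdj-sym (b ∷ bs) (suc i) (suc j) = thresholdAdj-sym bs i j

thresholdAdj-irrefl : (bs : Vec Bool m) → ∀ i → thresholdAdj bs i i ≡ false
thresholdAdj-irrefl []       i       = refl
thresholdAdj-irrefl (b ∷ bs) zero    = refl
thresholdAdj-irrefl (b ∷ bs) (suc i) = thresholdAdj-irrefl bs i

thresholdGraph : Vec Bool m → SimpleGraph (suc m)
thresholdGraph bs = record
  { adj    = thresholdAdj bs
  ; sym    = thresholdAdj-sym bs
  ; irrefl = thresholdAdj-irrefl bs
  }

degree-dominating : (bs : Vec Bool m) → degree (thresholdGraph (true ∷ bs)) zero ≡ suc m
degree-dominating {m} bs =
  trans (count-tabulate (T? ∘ thresholdAdj (true ∷ bs) zero) suc)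
        (count-all (λ _ → T? true) (λ _ → tt) (allFin (suc m)))

degree-isolated : (bs : Vec Bool m) → degree (thresholdGraph (false ∷ bs)) zero ≡ 0
degree-isolated {m} bs =
  trans (count-tabulate (T? ∘ thresholdAdj (false ∷ bs) zero) suc)
        (count-none (λ _ → T? false) (λ _ ()) (allFin (suc m)))

degree-suc : ∀ b (bs : Vec Bool m) i →
             degree (thresholdGraph (b ∷ bs)) (suc i) ≡ (if b then ℕ.suc else id) (degree (thresholdGraph bs) i)
degree-suc b bs i =
  cong (if b then ℕ.suc else id) (count-tabulate (T? ∘ thresholdAdj (b ∷ bs) (suc i)) suc)

enumEntry-thresholdGraph : ∀ b (bs : Vec Bool m) d →
  enumEntry (thresholdGraph (b ∷ bs)) d ≡
  (if does (degree (thresholdGraph (b ∷ bs)) zero ≟ d) then ℕ.suc else id)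
    (count (λ i → (if b then ℕ.suc else id) (degree (thresholdGraph bs) i) ≟ d) (allFin (suc m)))
enumEntry-thresholdGraph {m} b bs d =
  cong (if does (degree G zero ≟ d) then ℕ.suc else id)
    (trans (count-tabulate (λ i → degree G i ≟ d) suc)
           (count-cong _ _ (λ i → cong (does ∘ (_≟ d)) (degree-suc b bs i)) (allFin (suc m))))
  where G = thresholdGraph (b ∷ bs)

enumEntry-isolated : (bs : Vec Bool m) → ∀ d →
  enumEntry (thresholdGraph (false ∷ bs)) d ≡
  (if does (0 ≟ d) then ℕ.suc else id) (enumEntry (thresholdGraph bs) d)
enumEntry-isolated bs d = trans (enumEntry-thresholdGraph false bs d)
  (cong (λ δ → (if does (δ ≟ d) then ℕ.suc else id) (enumEntry (thresholdGraph bs) d))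
        (degree-isolated bs))

enumEntry-dominating : (bs : Vec Bool m) → ∀ d →
  enumEntry (thresholdGraph (true ∷ bs)) d ≡
  (if does (suc m ≟ d) then ℕ.suc else id)
    (count (λ i → suc (degree (thresholdGraph bs) i) ≟ d) (allFin (suc m)))
enumEntry-dominating {m} bs d = trans (enumEntry-thresholdGraph true bs d)
  (cong (λ δ → (if does (δ ≟ d) then ℕ.suc else id) (count (λ i → suc (degree G i) ≟ d) (allFin (suc m))))
        (degree-dominating bs))
  where G = thresholdGraph bs

enumEntry-dominating-zero : (bs : Vec Bool m) → enumEntry (thresholdGraph (true ∷ bs)) 0 ≡ 0
enumEntry-dominating-zero {m} bs = trans (enumEntry-dominating bs 0)
  (count-none (λ i → suc (degree (thresholdGraph bs) i) ≟ 0) (λ _ ()) (allFin (suc m)))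

enumEntry-dominating-suc : (bs : Vec Bool m) → ∀ d →
  enumEntry (thresholdGraph (true ∷ bs)) (suc d) ≡
  (if does (m ≟ d) then ℕ.suc else id) (enumEntry (thresholdGraph bs) d)
enumEntry-dominating-suc {m} bs d = trans (enumEntry-dominating bs (suc d))
  (cong (if does (m ≟ d) then ℕ.suc else id)
        (count-cong (λ i → suc (degree G i) ≟ suc d) (λ i → degree G i ≟ d) (λ _ → refl) (allFin (suc m))))
  where G = thresholdGraph bs

thresholdGraph-injective : (bs cs : Vec Bool m) →
  (∀ d → d < suc m → enumEntry (thresholdGraph bs) d ≡ enumEntry (thresholdGraph cs) d) →
  bs ≡ cs
thresholdGraph-injective []         []         _    = refl
thresholdGraph-injective {suc m} (true ∷ bs) (true ∷ cs) same =
  cong (true ∷_) (thresholdGraph-injective bs cs λ d d<1+m →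
    suc-or-id-injective (does (m ≟ d))
      (begin
        _ ≡⟨ enumEntry-dominating-suc bs d ⟨
        _ ≡⟨ same (suc d) (s≤s d<1+m) ⟩
        _ ≡⟨ enumEntry-dominating-suc cs d ⟩
        _ ∎))
  where open ≡-Reasoning
thresholdGraph-injective (false ∷ bs) (false ∷ cs) same =
  cong (false ∷_) (thresholdGraph-injective bs cs λ d d<1+m →
    suc-or-id-injective (does (0 ≟ d))
      (begin
        _ ≡⟨ enumEntry-isolated bs d ⟨
        _ ≡⟨ same d (m<n⇒m<1+n d<1+m) ⟩
        _ ≡⟨ enumEntry-isolated cs d ⟩
        _ ∎))
  where open ≡-Reasoning
thresholdGraph-injective (true ∷ bs) (false ∷ cs) same =
  ⊥-elim (0≢1+n (trans (≡-sym (enumEntry-dominating-zero bs))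
                       (trans (same 0 (s≤s z≤n)) (enumEntry-isolated cs 0))))
thresholdGraph-injective (false ∷ bs) (true ∷ cs) same =
  ⊥-elim (0≢1+n (trans (≡-sym (enumEntry-dominating-zero cs))
                       (trans (≡-sym (same 0 (s≤s z≤n))) (enumEntry-isolated bs 0))))

enumEntry-cong : (G H : SimpleGraph n) → degreeEnumerator G ≡ degreeEnumerator H →
                 ∀ d → d < n → enumEntry G d ≡ enumEntry H d
enumEntry-cong G H e d d<n = begin
  enumEntry G d                    ≡⟨ cong (enumEntry G) (toℕ-fromℕ< d<n) ⟨
  enumEntry G (toℕ i)              ≡⟨ lookup∘tabulate _ i ⟨
  lookup (degreeEnumerator G) i    ≡⟨ cong (λ v → lookup v i) e ⟩
  lookup (degreeEnumerator H) i    ≡⟨ lookup∘tabulate _ i ⟩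
  enumEntry H (toℕ i)              ≡⟨ cong (enumEntry H) (toℕ-fromℕ< d<n) ⟩
  enumEntry H d                    ∎
  where
  open ≡-Reasoning
  i = fromℕ< d<n

proposition2p3 : (k : ℕ) → 1 ≤ k →
    Σ (Fin ((2 * k) C k) → SimpleGraph (suc (2 * k))) λ G →
      ∀ a b → degreeEnumerator (G a) ≡ degreeEnumerator (G b) → a ≡ b
proposition2p3 k _ = G , λ a b same →
  combination-injective (2 * k) k
    (thresholdGraph-injective (combination (2 * k) k a) (combination (2 * k) k b)
      (enumEntry-cong (G a) (G b) same))
  where
  G : Fin ((2 * k) C k) → SimpleGraph (suc (2 * k))
  G = thresholdGraph ∘ combination (2 * k) k
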